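{- Let $G$ be a finite simple graph. If $G$ is not max-$\kappa$, then the double graph $\mathcal{D}[G]$ is not max-$\kappa$.
   Context: The total graph $T_2$ is $K_2$ with a loop added at each of its two vertices. The double graph is $\mathcal{D}[G]=G\times T_2$ (Kronecker product): it has vertex set $V(G)\times\{0,1\}$ and $(u,i)$ is adjacent to $(v,j)$ iff $uv\in E(G)$. For a graph $H$ with $p(H)\ge1$ vertices and $q(H)$ edges, $H$ is called max-$\kappa$ if $\kappa(H)=\lfloor 2q(H)/p(H)\rfloor$, where $\kappa$ is vertex-connectivity. -}

module Defs where

open import Data.Bool using (Bool; true; false; if_then_else_; _∧_)
open import Data.Nat using (ℕ; zero; suc; nonZero; _+_; _*_; _∸_; _≤_; _<ᵇ_; NonZero; _/_)
open import Data.Fin using (Fin; toℕ; splitAt)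
open import Data.Fin.Subset using (Subset; _∈_; _∉_; ∣_∣)
open import Data.List using (List; map; allFin)
open import Data.Nat.ListAction using (sum)
open import Data.Sum using (_⊎_; [_,_]′)
open import Data.Product using (Σ; ∃; _×_; _,_)
open import Relation.Binary.PropositionalEquality using (_≡_)
open import Relation.Nullary using (¬_)
open import Function using (id)

record Graph (n : ℕ) : Set where
  field
    adj    : Fin n → Fin n → Bool
    sym    : ∀ i j → adj i j ≡ adj j i
    irrefl : ∀ i → adj i i ≡ false
open Graph public

-- number of vertices p(H) is the index n; number of edges q(H):
-- unordered pairs {i,j} (counted once via toℕ i < toℕ j) with i ~ j.
edgeCount : ∀ {n} → Graph n → ℕ
edgeCount {n} G =
  sum (map (λ i → sum (map (λ j →
    if (adj G i j ∧ (toℕ i <ᵇ toℕ j)) then 1 else 0) (allFin n))) (allFin n))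

data Reach {n} (G : Graph n) (S : Subset n) (u : Fin n) : Fin n → Set where
  here : u ∉ S → Reach G S u u
  step : ∀ {w v} → Reach G S u w → adj G w v ≡ true → v ∉ S → Reach G S u v

-- S is a vertex cut in the sense of connectivity: H − S is disconnected
-- or has at most one vertex.
Separating : ∀ {n} → Graph n → Subset n → Set
Separating {n} G S =
  (n ∸ ∣ S ∣ ≤ 1)
  ⊎ (Σ (Fin n) λ u → Σ (Fin n) λ v → u ∉ S × v ∉ S × ¬ Reach G S u v)

IsConnectivity : ∀ {n} → Graph n → ℕ → Set
IsConnectivity {n} G k =
  (Σ (Subset n) λ S → Separating G S × ∣ S ∣ ≡ k)
  × (∀ (S : Subset n) → Separating G S → k ≤ ∣ S ∣)

MaxKappa : ∀ {n} .{{_ : NonZero n}} → Graph n → Set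
MaxKappa {n} G = IsConnectivity G ((2 * edgeCount G) / n)

-- Double graph D[G] = G × T₂ on vertex set Fin (n + n) ≅ Fin n × Fin 2:
-- the left copy is layer 0, the right copy layer 1; π forgets the layer.
proj : ∀ {n} → Fin (n + n) → Fin n
proj {n} x = [ id , id ]′ (splitAt n x)

double : ∀ {n} → Graph n → Graph (n + n)
double G = record
  { adj    = λ x y → adj G (proj x) (proj y)
  ; sym    = λ x y → sym G (proj x) (proj y)
  ; irrefl = λ x → irrefl G (proj x)
  }

double-nonZero : ∀ {n} .{{_ : NonZero n}} → NonZero (n + n)
double-nonZero {suc m} = nonZero

-- Let q and n be the numbers of edges and vertices of G and m = ⌊2q/n⌋. The double graph
-- has 2n vertices and 4q edges, so ⌊2q(D[G])/p(D[G])⌋ = ⌊4q/n⌋ ≥ 2m. Taking both copies of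
-- every vertex of a separating set S of G separates D[G], so κ(D[G]) ≤ 2|S|: if D[G] is
-- max-κ, every separating set of G has at least m vertices. Conversely G has a separating
-- set of exactly m vertices: a vertex v of minimum degree has deg v ≤ m, and an m-set
-- containing the neighbourhood of v but neither v nor some other vertex cuts v off (when
-- n ≤ m + 1, any m-set leaves at most one vertex). Hence κ(G) = m and G is max-κ.

module Submission where

open import Data.Bool using (Bool; true; false; if_then_else_; _∧_; T)
open import Data.Empty using (⊥; ⊥-elim)
open import Data.Fin using (Fin; zero; suc; toℕ; _↑ˡ_; _↑ʳ_; splitAt; _≟_)
open import Data.Fin.Properties using (splitAt-↑ˡ; splitAt-↑ʳ; toℕ-injective)
open import Data.Fin.Subset
  using (Subset; _∈_; _∉_; _⊆_; ∣_∣; inside; outside; ⊤; ∁; ⁅_⁆) renaming (⊥ to ∅)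
open import Data.Fin.Subset.Properties
  using ( drop-∷-⊆; out⊆; in⊆in; ⊥⊆; p⊆q⇒∣p∣≤∣q∣; ∣p∣≤n; ∣⊥∣≡0; ∣⊤∣≡n; ∣⁅x⁆∣≡1; ∣∁p∣≡n∸∣p∣
        ; x∈⁅x⁆; x∈⁅y⁆⇒x≡y; x∉⁅y⁆⇒x≢y; x∉p⇒x∈∁p; x∈∁p⇒x∉p; x∈p∧x≢y⇒x∈p-y; x∈p⇒∣p-x∣<∣p∣)
open import Data.List using (map; allFin)
import Data.List as List using (tabulate)
open import Data.List.Membership.Propositional.Properties using (∈-allFin)
import Data.List.Relation.Unary.All as All
open import Data.Nat
  using (ℕ; zero; suc; _+_; _*_; _∸_; _≤_; _<_; _<ᵇ_; z≤n; s≤s; s<s⁻¹; s≤s⁻¹; NonZero; _≤?_; _<?_; ≢-nonZero⁻¹)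
open import Data.Nat.DivMod using (_/_; m/n*n≤m; m*n/n≡m; /-monoˡ-≤)
open import Data.Nat.ListAction using () renaming (sum to sumᴸ)
open import Data.Nat.Properties
  using ( ≤-totalOrder; +-0-commutativeMonoid; module ≤-Reasoning
        ; ≤-reflexive; ≤-trans; ≤-antisym; <-trans; <-asym; <⇒≤; <⇒≱; ≰⇒>; ≮⇒≥; n<1+n
        ; <ᵇ⇒<; <⇒<ᵇ; +-comm; +-assoc; +-identityʳ; +-mono-≤; *-comm; *-assoc; *-monoʳ-≤
        ; *-cancelˡ-≡; *-cancelˡ-≤; ∸-monoˡ-≤; n∸n≡0; m≤n+o⇒m∸n≤o)
open import Algebra.Properties.CommutativeMonoid.Sum +-0-commutativeMonoid
  using (sum-syntax; ∑-distrib-+; ∑-comm; sum-cong-≗)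
open import Data.List.Extrema ≤-totalOrder using (argmin; f[argmin]≤f[xs])
open import Data.Nat.Solver using (module +-*-Solver)
open import Data.Product using (∃; _×_; _,_)
open import Data.Sum using (inj₁; inj₂)
open import Data.Vec using (_∷_; []; _++_; lookup; tabulate; here; there)
open import Data.Vec.Properties using (lookup∘tabulate; lookup-splitAt; []=⇒lookup; lookup⇒[]=)
open import Defs hiding (sym)
open import Function using (id; _∘_)
open import Relation.Binary.PropositionalEquality
  using (_≡_; _≢_; refl; sym; trans; cong; cong₂; subst; subst₂; module ≡-Reasoning)
open import Relation.Nullary using (¬_; yes; no)

∑-bounded-below : ∀ {n c} (f : Fin n → ℕ) → (∀ i → c ≤ f i) → n * c ≤ ∑[ i < n ] f i
∑-bounded-below {zero}  f c≤f = z≤n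
∑-bounded-below {suc n} f c≤f = +-mono-≤ (c≤f zero) (∑-bounded-below (f ∘ suc) (c≤f ∘ suc))

∃-n*f≤∑f : ∀ {n} (f : Fin (suc n) → ℕ) → ∃ λ i → suc n * f i ≤ ∑[ j < suc n ] f j
∃-n*f≤∑f {n} f = i , ∑-bounded-below f fi≤f
  where
  i : Fin (suc n)
  i = argmin f zero (allFin (suc n))
  fi≤f : ∀ j → f i ≤ f j
  fi≤f j = All.lookup (f[argmin]≤f[xs] {f = f} zero (allFin (suc n))) (∈-allFin j)

∑-↑ : ∀ m {n} (f : Fin (m + n) → ℕ) →
      ∑[ i < m + n ] f i ≡ ∑[ i < m ] f (i ↑ˡ n) + ∑[ j < n ] f (m ↑ʳ j)
∑-↑ zero    f = refl
∑-↑ (suc m) f = trans (cong (f zero +_) (∑-↑ m (f ∘ suc))) (sym (+-assoc (f zero) _ _))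

sum-map-tabulate : ∀ {A : Set} {n} (f : A → ℕ) (g : Fin n → A) →
                   sumᴸ (map f (List.tabulate g)) ≡ ∑[ i < n ] f (g i)
sum-map-tabulate {n = zero}  f g = refl
sum-map-tabulate {n = suc n} f g = cong (f (g zero) +_) (sum-map-tabulate f (g ∘ suc))

m*n≤o⇒m≤o/n : ∀ m n o .{{_ : NonZero n}} → m * n ≤ o → m ≤ o / n
m*n≤o⇒m≤o/n m n o m*n≤o = subst (_≤ o / n) (m*n/n≡m m n) (/-monoˡ-≤ n m*n≤o)

2*[m/n]≤[4*m]/[n+n] : ∀ m n .{{_ : NonZero n}} .{{_ : NonZero (n + n)}} →
                      2 * (m / n) ≤ (4 * m) / (n + n)
2*[m/n]≤[4*m]/[n+n] m n = m*n≤o⇒m≤o/n (2 * (m / n)) (n + n) (4 * m) (begin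
  2 * (m / n) * (n + n) ≡⟨ regroup (m / n) n ⟩
  4 * (m / n * n)       ≤⟨ *-monoʳ-≤ 4 (m/n*n≤m m n) ⟩
  4 * m                 ∎)
  where
  open ≤-Reasoning
  open +-*-Solver
  regroup : ∀ x y → 2 * x * (y + y) ≡ 4 * (x * y)
  regroup = solve 2 (λ x y → con 2 :* x :* (y :+ y) := con 4 :* (x :* y)) refl

<ᵇ≡true⇒< : ∀ {m n} → (m <ᵇ n) ≡ true → m < n
<ᵇ≡true⇒< {m} {n} m<ᵇn = <ᵇ⇒< m n (subst T (sym m<ᵇn) _)

<ᵇ≡false⇒≥ : ∀ {m n} → (m <ᵇ n) ≡ false → n ≤ m
<ᵇ≡false⇒≥ m<ᵇn = ≮⇒≥ λ m<n → subst T m<ᵇn (<⇒<ᵇ m<n)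

⟦_⟧ : Bool → ℕ
⟦ b ⟧ = if b then 1 else 0

⟦<ᵇ⟧+⟦>ᵇ⟧≡1 : ∀ {x y} → x ≢ y → ⟦ x <ᵇ y ⟧ + ⟦ y <ᵇ x ⟧ ≡ 1
⟦<ᵇ⟧+⟦>ᵇ⟧≡1 {x} {y} x≢y with x <ᵇ y in x<ᵇy | y <ᵇ x in y<ᵇx
... | true  | true  = ⊥-elim (<-asym (<ᵇ≡true⇒< {x} x<ᵇy) (<ᵇ≡true⇒< {y} y<ᵇx))
... | true  | false = refl
... | false | true  = refl
... | false | false = ⊥-elim (x≢y (≤-antisym (<ᵇ≡false⇒≥ y<ᵇx) (<ᵇ≡false⇒≥ x<ᵇy)))

⟦b⟧≡⟦b∧x<y⟧+⟦b∧y<x⟧ : ∀ b {x y} → x ≢ y → ⟦ b ⟧ ≡ ⟦ b ∧ (x <ᵇ y) ⟧ + ⟦ b ∧ (y <ᵇ x) ⟧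
⟦b⟧≡⟦b∧x<y⟧+⟦b∧y<x⟧ false _   = refl
⟦b⟧≡⟦b∧x<y⟧+⟦b∧y<x⟧ true  x≢y = sym (⟦<ᵇ⟧+⟦>ᵇ⟧≡1 x≢y)

private
  there-∖ : ∀ {s t n} {p q : Subset n} →
            (∃ λ x → x ∈ q × x ∉ p) → ∃ λ x → x ∈ t ∷ q × x ∉ s ∷ p
  there-∖ (x , x∈q , x∉p) = suc x , there x∈q , λ { (there x∈p) → x∉p x∈p }

∣p∣<∣q∣⇒∃∈q∖p : ∀ {n} {p q : Subset n} → ∣ p ∣ < ∣ q ∣ → ∃ λ x → x ∈ q × x ∉ p
∣p∣<∣q∣⇒∃∈q∖p {p = outside ∷ p} {inside  ∷ q} _   = zero , here , λ ()
∣p∣<∣q∣⇒∃∈q∖p {p = inside  ∷ p} {inside  ∷ q} p<q = there-∖ (∣p∣<∣q∣⇒∃∈q∖p (s<s⁻¹ p<q))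
∣p∣<∣q∣⇒∃∈q∖p {p = inside  ∷ p} {outside ∷ q} p<q = there-∖ (∣p∣<∣q∣⇒∃∈q∖p (<-trans (n<1+n _) p<q))
∣p∣<∣q∣⇒∃∈q∖p {p = outside ∷ p} {outside ∷ q} p<q = there-∖ (∣p∣<∣q∣⇒∃∈q∖p p<q)

x∈p∧y∈p∧x≢y⇒2≤∣p∣ : ∀ {n} {p : Subset n} {x y} → x ∈ p → y ∈ p → x ≢ y → 2 ≤ ∣ p ∣
x∈p∧y∈p∧x≢y⇒2≤∣p∣ x∈p y∈p x≢y = ≤-trans
  (s≤s (≤-trans (s≤s z≤n) (x∈p⇒∣p-x∣<∣p∣ (x∈p∧x≢y⇒x∈p-y y∈p (x≢y ∘ sym)))))
  (x∈p⇒∣p-x∣<∣p∣ x∈p)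

∣∁⁅x⁆∣≡n∸1 : ∀ {n} (x : Fin n) → ∣ ∁ ⁅ x ⁆ ∣ ≡ n ∸ 1
∣∁⁅x⁆∣≡n∸1 {n} x = trans (∣∁p∣≡n∸∣p∣ ⁅ x ⁆) (cong (n ∸_) (∣⁅x⁆∣≡1 x))

∣p++q∣≡∣p∣+∣q∣ : ∀ {m n} (p : Subset m) (q : Subset n) → ∣ p ++ q ∣ ≡ ∣ p ∣ + ∣ q ∣
∣p++q∣≡∣p∣+∣q∣ []            q = refl
∣p++q∣≡∣p∣+∣q∣ (inside  ∷ p) q = cong suc (∣p++q∣≡∣p∣+∣q∣ p q)
∣p++q∣≡∣p∣+∣q∣ (outside ∷ p) q = ∣p++q∣≡∣p∣+∣q∣ p q

intermediate-subset : ∀ {n m} {p q : Subset n} → p ⊆ q → ∣ p ∣ ≤ m → m ≤ ∣ q ∣ →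
                      ∃ λ s → p ⊆ s × s ⊆ q × ∣ s ∣ ≡ m
intermediate-subset {p = []} {[]} _ _ z≤n = [] , id , id , refl
intermediate-subset {p = inside ∷ p} {outside ∷ q} p⊆q _ _ with () ← p⊆q here
intermediate-subset {m = suc m} {inside ∷ p} {inside ∷ q} p⊆q p≤m m≤q
  with s , p⊆s , s⊆q , ∣s∣≡m ← intermediate-subset (drop-∷-⊆ p⊆q) (s≤s⁻¹ p≤m) (s≤s⁻¹ m≤q)
  = inside ∷ s , in⊆in p⊆s , in⊆in s⊆q , cong suc ∣s∣≡m
intermediate-subset {p = outside ∷ p} {outside ∷ q} p⊆q p≤m m≤q
  with s , p⊆s , s⊆q , ∣s∣≡m ← intermediate-subset (drop-∷-⊆ p⊆q) p≤m m≤q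
  = outside ∷ s , out⊆ p⊆s , out⊆ s⊆q , ∣s∣≡m
intermediate-subset {m = m} {outside ∷ p} {inside ∷ q} p⊆q p≤m m≤q with m ≤? ∣ q ∣
... | yes m≤q
  with s , p⊆s , s⊆q , ∣s∣≡m ← intermediate-subset (drop-∷-⊆ p⊆q) p≤m m≤q
  = outside ∷ s , out⊆ p⊆s , out⊆ s⊆q , ∣s∣≡m
intermediate-subset {m = zero} {outside ∷ _} {inside ∷ _} _ _ _ | no 0≰q = ⊥-elim (0≰q z≤n)
intermediate-subset {m = suc m} {outside ∷ p} {inside ∷ q} p⊆q p≤m m≤q | no m≰q
  with s , p⊆s , s⊆q , ∣s∣≡m ← intermediate-subset (drop-∷-⊆ p⊆q)
         (≤-trans (p⊆q⇒∣p∣≤∣q∣ (drop-∷-⊆ p⊆q)) (s≤s⁻¹ (≰⇒> m≰q))) (s≤s⁻¹ m≤q)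
  = inside ∷ s , out⊆ p⊆s , in⊆in s⊆q , cong suc ∣s∣≡m

neighbourhood : ∀ {n} → Graph n → Fin n → Subset n
neighbourhood G v = tabulate (adj G v)

degree : ∀ {n} → Graph n → Fin n → ℕ
degree G v = ∣ neighbourhood G v ∣

∣tabulate∣≡∑ : ∀ {n} (f : Fin n → Bool) → ∣ tabulate f ∣ ≡ ∑[ i < n ] ⟦ f i ⟧
∣tabulate∣≡∑ {zero}  f = refl
∣tabulate∣≡∑ {suc n} f with f zero
... | true  = cong suc (∣tabulate∣≡∑ (f ∘ suc))
... | false = ∣tabulate∣≡∑ (f ∘ suc)

module _ {n} (G : Graph n) where

  ¬loop : ∀ v → adj G v v ≢ true
  ¬loop v v~v with () ← trans (sym v~v) (irrefl G v)

  adj⇒∈neighbourhood : ∀ {v w} → adj G v w ≡ true → w ∈ neighbourhood G v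
  adj⇒∈neighbourhood {v} {w} v~w = lookup⇒[]= w _ (trans (lookup∘tabulate (adj G v) w) v~w)

  ∈neighbourhood⇒adj : ∀ {v w} → w ∈ neighbourhood G v → adj G v w ≡ true
  ∈neighbourhood⇒adj {v} {w} w∈N = trans (sym (lookup∘tabulate (adj G v) w)) ([]=⇒lookup w∈N)

  neighbourhood⊆∁⁅v⁆ : ∀ v → neighbourhood G v ⊆ ∁ ⁅ v ⁆
  neighbourhood⊆∁⁅v⁆ v w∈N = x∉p⇒x∈∁p λ w∈⁅v⁆ →
    ¬loop v (subst (λ w → adj G v w ≡ true) (x∈⁅y⁆⇒x≡y v w∈⁅v⁆) (∈neighbourhood⇒adj w∈N))

  arc : Fin n → Fin n → ℕ
  arc i j = ⟦ adj G i j ∧ (toℕ i <ᵇ toℕ j) ⟧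

  edgeCount≡∑arc : edgeCount G ≡ ∑[ i < n ] ∑[ j < n ] arc i j
  edgeCount≡∑arc = trans (sum-map-tabulate (λ i → sumᴸ (map (arc i) (allFin n))) id)
                         (sum-cong-≗ λ i → sum-map-tabulate (arc i) id)

  ⟦adj⟧≡arc+arc : ∀ i j → ⟦ adj G i j ⟧ ≡ arc i j + arc j i
  ⟦adj⟧≡arc+arc i j with i ≟ j
  ... | yes refl rewrite irrefl G i = refl
  ... | no i≢j   rewrite Graph.sym G j i = ⟦b⟧≡⟦b∧x<y⟧+⟦b∧y<x⟧ (adj G i j) (i≢j ∘ toℕ-injective)

  ∑degree≡2*edgeCount : ∑[ v < n ] degree G v ≡ 2 * edgeCount G
  ∑degree≡2*edgeCount = begin
    ∑[ v < n ] degree G v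
      ≡⟨ sum-cong-≗ (∣tabulate∣≡∑ ∘ adj G) ⟩
    ∑[ v < n ] ∑[ w < n ] ⟦ adj G v w ⟧
      ≡⟨ sum-cong-≗ (λ v → sum-cong-≗ (⟦adj⟧≡arc+arc v)) ⟩
    ∑[ v < n ] ∑[ w < n ] (arc v w + arc w v)
      ≡⟨ sum-cong-≗ (λ v → ∑-distrib-+ (arc v) (λ w → arc w v)) ⟩
    ∑[ v < n ] (∑[ w < n ] arc v w + ∑[ w < n ] arc w v)
      ≡⟨ ∑-distrib-+ (λ v → ∑[ w < n ] arc v w) (λ v → ∑[ w < n ] arc w v) ⟩
    E + ∑[ v < n ] ∑[ w < n ] arc w v
      ≡⟨ cong (E +_) (∑-comm (λ v w → arc w v)) ⟩
    E + E
      ≡⟨ cong (λ q → q + q) edgeCount≡∑arc ⟨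
    edgeCount G + edgeCount G
      ≡⟨ cong (edgeCount G +_) (+-identityʳ _) ⟨
    2 * edgeCount G ∎
    where
    open ≡-Reasoning
    E = ∑[ i < n ] ∑[ j < n ] arc i j

min-degree≤average : ∀ {n} (G : Graph (suc n)) →
                     ∃ λ v → degree G v ≤ (2 * edgeCount G) / suc n
min-degree≤average {n} G =
  let v , n*δ≤∑degree = ∃-n*f≤∑f (degree G)
  in  v , m*n≤o⇒m≤o/n (degree G v) (suc n) (2 * edgeCount G)
            (subst₂ _≤_ (*-comm (suc n) (degree G v)) (∑degree≡2*edgeCount G) n*δ≤∑degree)

reach-from-isolated : ∀ {n} {H : Graph n} {S u y} →
                      (∀ {w} → adj H u w ≡ true → w ∉ S → ⊥) → Reach H S u y → y ≡ u
reach-from-isolated isolated (here _) = refl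
reach-from-isolated isolated (step r w~y y∉S) with refl ← reach-from-isolated isolated r =
  ⊥-elim (isolated w~y y∉S)

n∸∣S∣≤1⇒unique-∉ : ∀ {n} {S : Subset n} {a b} → n ∸ ∣ S ∣ ≤ 1 → a ∉ S → b ∉ S → a ≡ b
n∸∣S∣≤1⇒unique-∉ {n} {S} {a} {b} n∸∣S∣≤1 a∉S b∉S with a ≟ b
... | yes a≡b = a≡b
... | no  a≢b = ⊥-elim (<⇒≱ (s≤s n∸∣S∣≤1) (begin
  2          ≤⟨ x∈p∧y∈p∧x≢y⇒2≤∣p∣ (x∉p⇒x∈∁p a∉S) (x∉p⇒x∈∁p b∉S) a≢b ⟩
  ∣ ∁ S ∣    ≡⟨ ∣∁p∣≡n∸∣p∣ S ⟩
  n ∸ ∣ S ∣  ∎))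
  where open ≤-Reasoning

neighbourhood-cut : ∀ {n} (G : Graph n) {S v w} → neighbourhood G v ⊆ S →
                    v ∉ S → w ∉ S → w ≢ v → Separating G S
neighbourhood-cut G N⊆S v∉S w∉S w≢v =
  inj₂ (_ , _ , v∉S , w∉S , λ v⇝w → w≢v (reach-from-isolated v-isolated v⇝w))
  where
  v-isolated : ∀ {u} → adj G _ u ≡ true → u ∉ _ → ⊥
  v-isolated v~u u∉S = u∉S (N⊆S (adj⇒∈neighbourhood G v~u))

separating-of-size-≤ : ∀ {n m} (G : Graph n) → n ≤ suc m → m ≤ n →
                       ∃ λ S → Separating G S × ∣ S ∣ ≡ m
separating-of-size-≤ {n} {m} G n≤1+m m≤n =
  let S , _ , _ , ∣S∣≡m = intermediate-subset {p = ∅} {q = ⊤} ⊥⊆ ∣∅∣≤m m≤∣⊤∣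
  in  S , inj₁ (subst (λ k → n ∸ k ≤ 1) (sym ∣S∣≡m) n∸m≤1) , ∣S∣≡m
  where
  ∣∅∣≤m : ∣ ∅ {n} ∣ ≤ m
  ∣∅∣≤m = subst (_≤ m) (sym (∣⊥∣≡0 n)) z≤n
  m≤∣⊤∣ : m ≤ ∣ ⊤ {n} ∣
  m≤∣⊤∣ = subst (m ≤_) (sym (∣⊤∣≡n n)) m≤n
  n∸m≤1 : n ∸ m ≤ 1
  n∸m≤1 = m≤n+o⇒m∸n≤o n m (subst (n ≤_) (+-comm 1 m) n≤1+m)

separating-of-size-> : ∀ {n m} (G : Graph n) (v : Fin n) → degree G v ≤ m → 2 + m ≤ n →
                       ∃ λ S → Separating G S × ∣ S ∣ ≡ m
separating-of-size-> {n} {m} G v δ≤m 2+m≤n =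
  let S , N⊆S , S⊆C , ∣S∣≡m = intermediate-subset (neighbourhood⊆∁⁅v⁆ G v) δ≤m (<⇒≤ m<∣C∣)
      w , w∈C , w∉S       = ∣p∣<∣q∣⇒∃∈q∖p (subst (_< ∣ C ∣) (sym ∣S∣≡m) m<∣C∣)
      v∉S                 = λ v∈S → x∈∁p⇒x∉p (S⊆C v∈S) (x∈⁅x⁆ v)
  in  S , neighbourhood-cut G N⊆S v∉S w∉S (x∉⁅y⁆⇒x≢y (x∈∁p⇒x∉p w∈C)) , ∣S∣≡m
  where
  C : Subset n
  C = ∁ ⁅ v ⁆
  m<∣C∣ : m < ∣ C ∣
  m<∣C∣ = subst (m <_) (sym (∣∁⁅x⁆∣≡n∸1 v)) (∸-monoˡ-≤ 1 2+m≤n)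

separating-of-size : ∀ {n m} (G : Graph n) (v : Fin n) → degree G v ≤ m → m ≤ n →
                     ∃ λ S → Separating G S × ∣ S ∣ ≡ m
separating-of-size {n} {m} G v δ≤m m≤n with n ≤? suc m
... | yes n≤1+m = separating-of-size-≤ G n≤1+m m≤n
... | no  n≰1+m = separating-of-size-> G v δ≤m (≰⇒> n≰1+m)

proj-↑ˡ : ∀ {n} (i : Fin n) → proj {n} (i ↑ˡ n) ≡ i
proj-↑ˡ {n} i rewrite splitAt-↑ˡ n i n = refl

proj-↑ʳ : ∀ {n} (i : Fin n) → proj {n} (n ↑ʳ i) ≡ i
proj-↑ʳ {n} i rewrite splitAt-↑ʳ n n i = refl

↑ˡ≢↑ʳ : ∀ {m n} (i : Fin m) (j : Fin n) → i ↑ˡ n ≢ m ↑ʳ j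
↑ˡ≢↑ʳ {m} {n} i j i≡j
  with () ← trans (sym (splitAt-↑ˡ m i n)) (trans (cong (splitAt m) i≡j) (splitAt-↑ʳ m n j))

∑-proj : ∀ {n} (f : Fin n → ℕ) → ∑[ x < n + n ] f (proj x) ≡ ∑[ i < n ] f i + ∑[ i < n ] f i
∑-proj {n} f = trans (∑-↑ n (f ∘ proj))
  (cong₂ _+_ (sum-cong-≗ (cong f ∘ proj-↑ˡ)) (sum-cong-≗ (cong f ∘ proj-↑ʳ)))

lookup-++-proj : ∀ {n} (S : Subset n) x → lookup (S ++ S) x ≡ lookup S (proj x)
lookup-++-proj {n} S x rewrite lookup-splitAt n S S x with splitAt n x
... | inj₁ i = refl
... | inj₂ i = refl

∈-doubled⁺ : ∀ {n} {S : Subset n} {x} → proj x ∈ S → x ∈ S ++ S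
∈-doubled⁺ {S = S} {x} πx∈S =
  lookup⇒[]= x (S ++ S) (trans (lookup-++-proj S x) ([]=⇒lookup πx∈S))

∈-doubled⁻ : ∀ {n} {S : Subset n} {x} → x ∈ S ++ S → proj x ∈ S
∈-doubled⁻ {S = S} {x} x∈SS =
  lookup⇒[]= (proj x) S (trans (sym (lookup-++-proj S x)) ([]=⇒lookup x∈SS))

module _ {n} (G : Graph n) where

  degree-double : ∀ x → degree (double G) x ≡ degree G (proj x) + degree G (proj x)
  degree-double x = begin
    degree (double G) x
      ≡⟨ ∣tabulate∣≡∑ (λ y → adj G (proj x) (proj y)) ⟩
    ∑[ y < n + n ] ⟦ adj G (proj x) (proj y) ⟧
      ≡⟨ ∑-proj (λ j → ⟦ adj G (proj x) j ⟧) ⟩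
    ∑[ j < n ] ⟦ adj G (proj x) j ⟧ + ∑[ j < n ] ⟦ adj G (proj x) j ⟧
      ≡⟨ cong (λ d → d + d) (∣tabulate∣≡∑ (adj G (proj x))) ⟨
    degree G (proj x) + degree G (proj x) ∎
    where open ≡-Reasoning

  edgeCount-double : edgeCount (double G) ≡ 4 * edgeCount G
  edgeCount-double = *-cancelˡ-≡ _ _ 2 (begin
    2 * edgeCount (double G)
      ≡⟨ ∑degree≡2*edgeCount (double G) ⟨
    ∑[ x < n + n ] degree (double G) x
      ≡⟨ sum-cong-≗ degree-double ⟩
    ∑[ x < n + n ] (degree G (proj x) + degree G (proj x))
      ≡⟨ ∑-distrib-+ (degree G ∘ proj) (degree G ∘ proj) ⟩
    ∑[ x < n + n ] degree G (proj x) + ∑[ x < n + n ] degree G (proj x)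
      ≡⟨ cong (λ d → d + d) (∑-proj (degree G)) ⟩
    (∑δ + ∑δ) + (∑δ + ∑δ)
      ≡⟨ cong (λ d → (d + d) + (d + d)) (∑degree≡2*edgeCount G) ⟩
    (2 * q + 2 * q) + (2 * q + 2 * q)
      ≡⟨ solve 1 (λ q → (con 2 :* q :+ con 2 :* q) :+ (con 2 :* q :+ con 2 :* q)
                         := con 2 :* (con 4 :* q)) refl q ⟩
    2 * (4 * q) ∎)
    where
    open ≡-Reasoning
    open +-*-Solver
    q ∑δ : ℕ
    q = edgeCount G
    ∑δ = ∑[ i < n ] degree G i

module _ {n} (G : Graph n) (S : Subset n) where

  reach-proj : ∀ {x y} → Reach (double G) (S ++ S) x y → Reach G S (proj x) (proj y)
  reach-proj (here x∉SS)       = here (x∉SS ∘ ∈-doubled⁺)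
  reach-proj (step r w~y y∉SS) = step (reach-proj r) w~y (y∉SS ∘ ∈-doubled⁺)

  separating-double : Separating G S → Separating (double G) (S ++ S)
  separating-double (inj₂ (u , v , u∉S , v∉S , u⇏v)) =
    inj₂ (u ↑ˡ n , v ↑ˡ n , ↑ˡ∉ u∉S , ↑ˡ∉ v∉S ,
          λ u⇝v → u⇏v (subst₂ (Reach G S) (proj-↑ˡ u) (proj-↑ˡ v) (reach-proj u⇝v)))
    where
    ↑ˡ∉ : ∀ {i} → i ∉ S → i ↑ˡ n ∉ S ++ S
    ↑ˡ∉ {i} i∉S i∈SS = i∉S (subst (_∈ S) (proj-↑ˡ i) (∈-doubled⁻ i∈SS))
  separating-double (inj₁ n∸∣S∣≤1) with ∣ S ∣ <? n
  ... | no ∣S∣≮n =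
    inj₁ (≤-trans (≤-reflexive (trans (cong (n + n ∸_) ∣SS∣≡n+n) (n∸n≡0 (n + n)))) z≤n)
    where
    ∣SS∣≡n+n : ∣ S ++ S ∣ ≡ n + n
    ∣SS∣≡n+n = trans (∣p++q∣≡∣p∣+∣q∣ S S) (cong (λ k → k + k) (≤-antisym (∣p∣≤n S) (≮⇒≥ ∣S∣≮n)))
  -- G − S is the single vertex w; its two copies in D[G] are not adjacent, as G has no loops.
  ... | yes ∣S∣<n
    with w , _ , w∉S ← ∣p∣<∣q∣⇒∃∈q∖p {p = S} {q = ⊤} (subst (∣ S ∣ <_) (sym (∣⊤∣≡n n)) ∣S∣<n) =
    inj₂ (w ↑ˡ n , n ↑ʳ w , ↑∉ (proj-↑ˡ w) , ↑∉ (proj-↑ʳ w) ,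
          λ w₀⇝w₁ → ↑ˡ≢↑ʳ w w (sym (reach-from-isolated w₀-isolated w₀⇝w₁)))
    where
    ↑∉ : ∀ {x} → proj x ≡ w → x ∉ S ++ S
    ↑∉ πx≡w x∈SS = w∉S (subst (_∈ S) πx≡w (∈-doubled⁻ x∈SS))
    w₀-isolated : ∀ {y} → adj (double G) (w ↑ˡ n) y ≡ true → y ∉ S ++ S → ⊥
    w₀-isolated w~y y∉SS = ¬loop G w (subst₂ (λ a b → adj G a b ≡ true) (proj-↑ˡ w)
      (n∸∣S∣≤1⇒unique-∉ n∸∣S∣≤1 (y∉SS ∘ ∈-doubled⁺) w∉S) w~y)

proposition2p2 : ∀ {n} .{{_ : NonZero n}} (G : Graph n) →
                   ¬ MaxKappa G → ¬ MaxKappa {{double-nonZero}} (double G)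
proposition2p2 {zero} G _ _ = ⊥-elim (≢-nonZero⁻¹ 0 refl)
proposition2p2 {suc n} G G-not-max ((T , _ , ∣T∣≡κ) , κ-minimal) =
  G-not-max (cut-of-size-m , m-minimal)
  where
  open ≤-Reasoning
  q m κ : ℕ
  q = edgeCount G
  m = (2 * q) / suc n
  κ = (2 * edgeCount (double G)) / (suc n + suc n)

  2m≤κ : 2 * m ≤ κ
  2m≤κ = begin
    2 * m                             ≤⟨ 2*[m/n]≤[4*m]/[n+n] (2 * q) (suc n) ⟩
    (4 * (2 * q)) / (suc n + suc n)   ≡⟨ cong (_/ (suc n + suc n)) (trans (sym (*-assoc 4 2 q)) (*-assoc 2 4 q)) ⟩
    (2 * (4 * q)) / (suc n + suc n)   ≡⟨ cong (λ e → (2 * e) / (suc n + suc n)) (edgeCount-double G) ⟨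
    κ                                 ∎

  m-minimal : ∀ S → Separating G S → m ≤ ∣ S ∣
  m-minimal S S-separates = *-cancelˡ-≤ 2 (begin
    2 * m          ≤⟨ 2m≤κ ⟩
    κ              ≤⟨ κ-minimal (S ++ S) (separating-double G S S-separates) ⟩
    ∣ S ++ S ∣     ≡⟨ ∣p++q∣≡∣p∣+∣q∣ S S ⟩
    ∣ S ∣ + ∣ S ∣  ≡⟨ cong (∣ S ∣ +_) (+-identityʳ ∣ S ∣) ⟨
    2 * ∣ S ∣      ∎)

  m≤n : m ≤ suc n
  m≤n = *-cancelˡ-≤ 2 (begin
    2 * m          ≤⟨ 2m≤κ ⟩
    κ              ≡⟨ ∣T∣≡κ ⟨
    ∣ T ∣          ≤⟨ ∣p∣≤n T ⟩
    suc n + suc n  ≡⟨ cong (suc n +_) (+-identityʳ (suc n)) ⟨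
    2 * suc n      ∎)

  cut-of-size-m : ∃ λ S → Separating G S × ∣ S ∣ ≡ m
  cut-of-size-m = let v , δ≤m = min-degree≤average G in separating-of-size G v δ≤m m≤n
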